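{- Let $k\ge 2$, $n$ and $p$ be positive integers with $2(p-1)<n$. In every shuffle-preserved $2$-coloring of the $n\times n\times\cdots\times n$ complete $k$-partite multigraph, there is a monochromatic copy of the complete $p\times p\times\cdots\times p$ $k$-partite graph.
   Context: The complete $n\times\cdots\times n$ $k$-partite multigraph has vertex set $S_1\cup\cdots\cup S_k$ (disjoint parts, $|S_i|=n$), edges only between vertices in different parts, possibly multiple edges (no loops), and every two vertices in different parts joined by at least one edge. A $2$-coloring assigns to each edge one of at most $2$ colors. For a color $c$, let $W_c$ be the set of vertices incident to an edge of color $c$; the coloring is shuffle-preserved if for every color $c$, any two vertices of $W_c$ lying in different parts are joined by an edge of color $c$. A monochromatic copy of the complete $p\times\cdots\times p$ $k$-partite graph consists of sets $A_i\subseteq S_i$ with $|A_i|=p$ ($i=1,\dots,k$) and a color $c$ such that any two vertices in distinct $A_i, A_j$ are joined by an edge of color $c$. -}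

module Defs where

open import Data.Nat using (ℕ)
open import Data.Fin using (Fin)
open import Data.Product using (Σ; ∃; _×_; _,_; proj₁)
open import Data.Sum using (_⊎_)
open import Relation.Binary.PropositionalEquality using (_≡_; _≢_)
open import Relation.Nullary using (¬_)
open import Function.Definitions using (Injective)

-- vertex (i , x) is the x-th vertex of part S_i
Vertex : ℕ → ℕ → Set
Vertex k n = Fin k × Fin n

part : ∀ {k n} → Vertex k n → Fin k
part = proj₁

record ColouredMultigraph (k n : ℕ) : Set₁ where
  field
    Edge   : Set
    ends   : Edge → Vertex k n × Vertex k n
    colour : Edge → Fin 2

Joined : ∀ {k n} → ColouredMultigraph k n → Vertex k n → Vertex k n → Fin 2 → Set
Joined G u v c = Σ Edge λ e → colour e ≡ c × (ends e ≡ (u , v) ⊎ ends e ≡ (v , u))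
  where open ColouredMultigraph G

IsCompleteMultipartite : ∀ {k n} → ColouredMultigraph k n → Set
IsCompleteMultipartite {k} {n} G =
  (∀ e → part (proj₁ (ends e)) ≢ part (Data.Product.proj₂ (ends e)))
  × (∀ (u v : Vertex k n) → part u ≢ part v → ∃ λ c → Joined G u v c)
  where open ColouredMultigraph G

InW : ∀ {k n} → ColouredMultigraph k n → Fin 2 → Vertex k n → Set
InW {k} {n} G c v = ∃ λ (u : Vertex k n) → Joined G v u c

ShufflePreserved : ∀ {k n} → ColouredMultigraph k n → Set
ShufflePreserved {k} {n} G =
  ∀ (c : Fin 2) (u v : Vertex k n) → InW G c u → InW G c v → part u ≢ part v → Joined G u v c

-- monochromatic copy of the complete p×⋯×p k-partite graph:
-- A i ⊆ S_i with |A i| = p (given as an injection Fin p → Fin n), and a colour c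
MonoCopy : ∀ {k n} → ColouredMultigraph k n → ℕ → Set
MonoCopy {k} {n} G p =
  Σ (Fin 2) λ c → Σ (Fin k → Fin p → Fin n) λ A →
    (∀ i → Injective _≡_ _≡_ (A i))
    × (∀ (i j : Fin k) → i ≢ j → ∀ (a b : Fin p) → Joined G (i , A i a) (j , A j b) c)

-- Since every vertex has an edge, a vertex outside W_{1−c} is a c-star: it is
-- joined in colour c to every vertex of the other parts, which therefore all lie
-- in W_c. If W₀ or W₁ contains every vertex, any p vertices per part form a
-- monochromatic copy by shuffle preservation. Otherwise there is a 0-star in
-- some part S_i, so W₀ ⊇ V ∖ S_i; either S_i ⊆ W₀ as well, or S_i contains a
-- 1-star and V ∖ S_i ⊆ W₀ ∩ W₁. In the latter case colour each vertex of S_i by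
-- an edge to a fixed vertex outside S_i; as n ≥ 2p − 1, some p of them share a
-- colour c, they lie in W_c, and again shuffle preservation finishes.
module Submission where

open import Defs
open import Data.Nat using (ℕ; _≤_; _<_; _*_; _∸_; zero; suc; _+_; s≤s)
open import Data.Nat.Properties using (+-suc; +-identityʳ; ≤-trans; m≤m+n; n≮0)
open import Data.Fin using (Fin; zero; suc; inject≤; lift; punchIn; _≟_)
open import Data.Fin.Properties using (inject≤-injective; lift-injective; suc-injective; punchInᵢ≢i)
open import Data.Product using (Σ; ∃; _×_; _,_; proj₁; proj₂)
open import Data.Sum using (_⊎_; inj₁; inj₂; [_,_]′)
open import Data.Empty using (⊥-elim)
open import Relation.Nullary using (yes; no)
open import Relation.Binary.PropositionalEquality using (_≡_; _≢_; refl; sym; subst)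
open import Function using (_∘_)
open import Function.Definitions using (Injective)

all⊎any : ∀ {n} {P Q : Fin n → Set} → (∀ i → P i ⊎ Q i) → (∀ i → P i) ⊎ ∃ Q
all⊎any {zero} d = inj₁ λ ()
all⊎any {suc n} d with d zero | all⊎any (d ∘ suc)
... | inj₂ q | _            = inj₂ (zero , q)
... | inj₁ _ | inj₂ (i , q) = inj₂ (suc i , q)
... | inj₁ p | inj₁ ps      = inj₁ λ { zero → p ; (suc i) → ps i }

all⊎any² : ∀ {k n} {P Q : Fin k × Fin n → Set} → (∀ v → P v ⊎ Q v) → (∀ v → P v) ⊎ ∃ Q
all⊎any² d with all⊎any (λ i → all⊎any (λ x → d (i , x)))
... | inj₁ ps           = inj₁ λ (i , x) → ps i x
... | inj₂ (i , x , q) = inj₂ ((i , x) , q)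

swap : ∀ {A B : Set} → A ⊎ B → B ⊎ A
swap = [ inj₂ , inj₁ ]′

flip : Fin 2 → Fin 2
flip zero       = suc zero
flip (suc zero) = zero

≡⊎≡flip : ∀ c d → d ≡ c ⊎ d ≡ flip c
≡⊎≡flip zero       zero       = inj₁ refl
≡⊎≡flip zero       (suc zero) = inj₂ refl
≡⊎≡flip (suc zero) zero       = inj₂ refl
≡⊎≡flip (suc zero) (suc zero) = inj₁ refl

LargeFibre : ∀ {n} → (Fin n → Fin 2) → Fin 2 → ℕ → Set
LargeFibre {n} g c p = Σ (Fin p → Fin n) λ f → Injective _≡_ _≡_ f × (∀ a → g (f a) ≡ c)

largeFibre-empty : ∀ {n} (g : Fin n → Fin 2) {c} → LargeFibre g c 0
largeFibre-empty _ = (λ ()) , (λ { {()} }) , λ ()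

module _ {n} (g : Fin (suc n) → Fin 2) {c : Fin 2} where

  largeFibre-shift : ∀ {p} → LargeFibre (g ∘ suc) c p → LargeFibre g c p
  largeFibre-shift (f , f-inj , gf≡c) = suc ∘ f , f-inj ∘ suc-injective , gf≡c

  largeFibre-extend : ∀ {p} → g zero ≡ c → LargeFibre (g ∘ suc) c p → LargeFibre g c (suc p)
  largeFibre-extend g0≡c (f , f-inj , gf≡c) =
    lift 1 f , lift-injective f f-inj 1 , λ { zero → g0≡c ; (suc a) → gf≡c a }

pigeonhole₂ : ∀ {n p q} → p + q ≤ suc n → (g : Fin n → Fin 2) →
  LargeFibre g zero p ⊎ LargeFibre g (suc zero) q
pigeonhole₂ {p = zero}         _ g = inj₁ (largeFibre-empty g)
pigeonhole₂ {p = suc _} {zero} _ g = inj₂ (largeFibre-empty g)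
pigeonhole₂ {zero} {suc p} {suc q} (s≤s p+1+q≤0) _ =
  ⊥-elim (n≮0 (subst (_≤ 0) (+-suc p q) p+1+q≤0))
pigeonhole₂ {suc n} {suc p} {suc q} (s≤s p+1+q≤1+n) g with g zero in g0
... | zero = [ inj₁ ∘ largeFibre-extend g g0 , inj₂ ∘ largeFibre-shift g ]′
               (pigeonhole₂ p+1+q≤1+n (g ∘ suc))
... | suc zero = [ inj₁ ∘ largeFibre-shift g , inj₂ ∘ largeFibre-extend g g0 ]′
                   (pigeonhole₂ (subst (_≤ suc n) (+-suc p q) p+1+q≤1+n) (g ∘ suc))

module _ {k n : ℕ} (G : ColouredMultigraph k n) where

  Joined-sym : ∀ {u v c} → Joined G u v c → Joined G v u c
  Joined-sym (e , colour≡c , inj₁ ends≡uv) = e , colour≡c , inj₂ ends≡uv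
  Joined-sym (e , colour≡c , inj₂ ends≡vu) = e , colour≡c , inj₁ ends≡vu

  Star : Fin 2 → Vertex k n → Set
  Star c v = ∀ u → part u ≢ part v → Joined G v u c

  CoveredOutside : Fin 2 → Fin k → Set
  CoveredOutside c i = ∀ u → part u ≢ i → InW G c u

  star⇒coveredOutside : ∀ {c v} → Star c v → CoveredOutside c (part v)
  star⇒coveredOutside {v = v} star u u∉i = v , Joined-sym (star u u∉i)

  Complete : Set
  Complete = ∀ u v → part u ≢ part v → ∃ λ c → Joined G u v c

  module _ (complete : Complete) where

    star⊎inW-flip : ∀ c v → Star c v ⊎ InW G (flip c) v
    star⊎inW-flip c v = all⊎any² joinedc⊎joinedFlip
      where
      joinedc⊎joinedFlip : ∀ u → (part u ≢ part v → Joined G v u c) ⊎ Joined G v u (flip c)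
      joinedc⊎joinedFlip u with part u ≟ part v
      ... | yes same = inj₁ λ different → ⊥-elim (different same)
      ... | no different with complete v u (different ∘ sym)
      ...   | d , v-u = [ (λ d≡c → inj₁ λ _ → subst (Joined G v u) d≡c v-u)
                        , (λ d≡flipc → inj₂ (subst (Joined G v u) d≡flipc v-u))
                        ]′ (≡⊎≡flip c d)

  module _ (shuffle : ShufflePreserved G) {p : ℕ} where

    inW⇒monoCopy : ∀ c (A : Fin k → Fin p → Fin n) → (∀ i → Injective _≡_ _≡_ (A i)) →
      (∀ i a → InW G c (i , A i a)) → MonoCopy G p
    inW⇒monoCopy c A A-inj A∈W = c , A , A-inj , λ i j i≢j a b →
      shuffle c (i , A i a) (j , A j b) (A∈W i a) (A∈W j b) i≢j

    module _ (p≤n : p ≤ n) where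

      initial : Fin p → Fin n
      initial a = inject≤ a p≤n

      initial-injective : Injective _≡_ _≡_ initial
      initial-injective = inject≤-injective p≤n p≤n _ _

      allInW⇒monoCopy : ∀ c → (∀ v → InW G c v) → MonoCopy G p
      allInW⇒monoCopy c all∈W =
        inW⇒monoCopy c (λ _ → initial) (λ _ → initial-injective) (λ _ _ → all∈W _)

      coveredOutside⇒monoCopy : ∀ c i → CoveredOutside c i → (f : Fin p → Fin n) →
        Injective _≡_ _≡_ f → (∀ a → InW G c (i , f a)) → MonoCopy G p
      coveredOutside⇒monoCopy c i covered f f-inj f∈W = inW⇒monoCopy c A A-inj A∈W
        where
        A : Fin k → Fin p → Fin n
        A j with j ≟ i
        ... | yes _ = f
        ... | no _  = initial
        A-inj : ∀ j → Injective _≡_ _≡_ (A j)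
        A-inj j with j ≟ i
        ... | yes _ = f-inj
        ... | no _  = initial-injective
        A∈W : ∀ j a → InW G c (j , A j a)
        A∈W j a with j ≟ i
        ... | yes refl = f∈W a
        ... | no j≢i   = covered (j , initial a) j≢i

      module _ (complete : Complete) (p+p≤1+n : p + p ≤ suc n) where

        bothCoveredOutside⇒monoCopy : ∀ i → CoveredOutside zero i → CoveredOutside (suc zero) i →
          (u : Vertex k n) → part u ≢ i → MonoCopy G p
        bothCoveredOutside⇒monoCopy i covered₀ covered₁ u u∉i =
          [ fibre⇒monoCopy zero covered₀ , fibre⇒monoCopy (suc zero) covered₁ ]′
            (pigeonhole₂ p+p≤1+n colourTo-u)
          where
          edgeTo-u : ∀ z → ∃ λ c → Joined G (i , z) u c
          edgeTo-u z = complete (i , z) u (u∉i ∘ sym)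
          colourTo-u : Fin n → Fin 2
          colourTo-u = proj₁ ∘ edgeTo-u
          fibre⇒monoCopy : ∀ c → CoveredOutside c i → LargeFibre colourTo-u c p → MonoCopy G p
          fibre⇒monoCopy c covered (f , f-inj , f-colour) =
            coveredOutside⇒monoCopy c i covered f f-inj
              λ a → u , subst (Joined G (i , f a) u) (f-colour a) (proj₂ (edgeTo-u (f a)))

        monoCopy : (∀ i → ∃ λ j → j ≢ i) → MonoCopy G p
        monoCopy other with all⊎any² (swap ∘ star⊎inW-flip complete zero)
        ... | inj₁ all∈W₁ = allInW⇒monoCopy (suc zero) all∈W₁
        ... | inj₂ ((i , x) , star₀)
            with all⊎any (λ y → swap (star⊎inW-flip complete (suc zero) (i , y)))
        ...   | inj₁ part∈W₀ =
                  coveredOutside⇒monoCopy zero i (star⇒coveredOutside star₀)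
                    initial initial-injective (part∈W₀ ∘ initial)
        ...   | inj₂ (y , star₁) =
                  bothCoveredOutside⇒monoCopy i (star⇒coveredOutside star₀)
                    (star⇒coveredOutside star₁) (proj₁ (other i) , x) (proj₂ (other i))

bound⇒p+p≤1+n : ∀ p n → 1 ≤ p → 2 * (p ∸ 1) < n → p + p ≤ suc n
bound⇒p+p≤1+n (suc p) n _ 2p<n rewrite +-identityʳ p =
  s≤s (subst (_≤ n) (sym (+-suc p p)) 2p<n)

bound⇒p≤n : ∀ p n → 1 ≤ p → 2 * (p ∸ 1) < n → p ≤ n
bound⇒p≤n (suc p) n _ 2p<n = ≤-trans (s≤s (m≤m+n p (p + 0))) 2p<n

corollary2 : (k n p : ℕ) → 2 ≤ k → 1 ≤ n → 1 ≤ p → 2 * (p ∸ 1) < n →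
    (G : ColouredMultigraph k n) → IsCompleteMultipartite G → ShufflePreserved G →
    MonoCopy G p
corollary2 (suc zero) _ _ (s≤s ()) _ _ _ _ _ _
corollary2 (suc (suc _)) n p _ _ 1≤p 2[p-1]<n G (_ , complete) shuffle =
  monoCopy G shuffle (bound⇒p≤n p n 1≤p 2[p-1]<n)
    complete (bound⇒p+p≤1+n p n 1≤p 2[p-1]<n)
    λ i → punchIn i zero , punchInᵢ≢i i zero
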